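{- Let $\mathcal{I}$ be an inference system over a set $\mathcal{S}$ of propositions which is finite in conclusions and has a complement $\mathcal{J}$. Then for all $X\subseteq\mathcal{S}$, $F_{\mathcal{J}}(X)=\mathcal{S}\setminus F_{\mathcal{I}}(\mathcal{S}\setminus X)$; that is, $F_{\mathcal{J}}$ is the conjugate of $F_{\mathcal{I}}$.
   Context: An inference rule is a partial function $f:\mathcal{S}^n\rightharpoonup\mathcal{S}$ for some $n\ge0$; $B$ is derivable from $\langle A_1,\dots,A_n\rangle$ with $f$ if $f(A_1,\dots,A_n)$ is defined and equals $B$. An inference system $\mathcal{K}$ is a set of rules and defines $F_{\mathcal{K}}(X)=\{f(A_1,\dots,A_n)\mid f\in\mathcal{K},\ A_1,\dots,A_n\in X,\ \langle A_1,\dots,A_n\rangle\in\mathrm{dom}(f)\}$. A system is finite in conclusions if each proposition is derivable with a rule of the system from only finitely many sequences. A system $\mathcal{J}$ is a complement of $\mathcal{I}$ (finite in conclusions) if $\mathcal{J}$ is finite in conclusions and for every $B$, if $\langle A^1_1,\dots,A^1_{n_1}\rangle,\dots,\langle A^p_1,\dots,A^p_{n_p}\rangle$ are all sequences from which $B$ is derivable with a rule of $\mathcal{I}$, then the sequences from which $B$ is derivable with a rule of $\mathcal{J}$ are exactly the $\langle A^1_{j_1},\dots,A^p_{j_p}\rangle$ with $1\le j_i\le n_i$. -}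

module Defs where

open import Data.Nat using (ℕ)
open import Data.Bool using (Bool; true; false)
open import Data.List using (List)
open import Data.Vec using (Vec; toList)
open import Data.Product using (Σ; _×_)
open import Data.List.Membership.Propositional using (_∈_)
open import Data.List.Relation.Unary.All using (All)
open import Data.List.Relation.Unary.Unique.Propositional using (Unique)
open import Data.List.Relation.Binary.Pointwise using (Pointwise)
open import Function.Bundles using (_⇔_)
open import Relation.Binary.PropositionalEquality using (_≡_)

Subset : Set → Set
Subset S = S → Bool

_∈ˢ_ : {S : Set} → S → Subset S → Set
A ∈ˢ X = X A ≡ true

∁ : {S : Set} → Subset S → Subset S
∁ X A with X A
... | true  = false
... | false = true

-- An inference rule: a partial function f : S^n ⇀ S, given by its
-- arity n, its domain, and its value on the domain.
record Rule (S : Set) : Set₁ where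
  field
    arity : ℕ
    dom   : Vec S arity → Set
    app   : (v : Vec S arity) → dom v → S

record InfSys (S : Set) : Set₁ where
  field
    Idx  : Set
    rule : Idx → Rule S

open Rule
open InfSys

Derivable : {S : Set} → InfSys S → S → List S → Set
Derivable K B σ =
  Σ (Idx K) λ k →
  Σ (Vec _ (arity (rule K k))) λ v →
  (toList v ≡ σ) ×
  Σ (dom (rule K k) v) λ d → app (rule K k) v d ≡ B

F : {S : Set} → InfSys S → Subset S → S → Set
F K X B = Σ (List _) λ σ → All (_∈ˢ X) σ × Derivable K B σ

FiniteInConclusions : {S : Set} → InfSys S → Set
FiniteInConclusions {S} K =
  (B : S) → Σ (List (List S)) λ L → (σ : List S) → Derivable K B σ → σ ∈ L

-- J is a complement of I: for every B, listing the (distinct) sequences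
-- σ_1..σ_p from which B is I-derivable, the sequences from which B is
-- J-derivable are exactly the choice sequences ⟨A^1_{j_1},..,A^p_{j_p}⟩
-- with A^i_{j_i} ∈ σ_i.
IsComplement : {S : Set} → InfSys S → InfSys S → Set
IsComplement {S} I J =
  FiniteInConclusions J ×
  ((B : S) → Σ (List (List S)) λ L →
     Unique L ×
     ((σ : List S) → (σ ∈ L) ⇔ Derivable I B σ) ×
     ((w : List S) → Derivable J B w ⇔ Pointwise _∈_ w L))

-- B is J-derivable from X iff some choice sequence ⟨A¹,…,Aᵖ⟩ with Aⁱ ∈ σᵢ lies in X,
-- where σ₁,…,σₚ are the I-premise sequences of B. Such a choice exists iff every σᵢ
-- meets X, i.e. iff no σᵢ lies in S ∖ X, i.e. iff B ∉ F_I(S ∖ X).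
{-# OPTIONS --safe #-}
module Submission where

open import Defs
open import Data.Bool using (true; false)
open import Data.Empty using (⊥-elim)
open import Data.List using (List; []; _∷_)
open import Data.List.Membership.Propositional using (_∈_; find)
open import Data.List.Relation.Unary.All as All using (All; []; _∷_)
open import Data.List.Relation.Unary.Any using (Any; here; there)
open import Data.List.Relation.Binary.Pointwise using (Pointwise; []; _∷_)
open import Data.Product using (_×_; ∃; _,_)
open import Data.Sum using (_⊎_; inj₁; inj₂)
open import Function.Bundles using (_⇔_; mk⇔; Equivalence)
open import Relation.Nullary using (¬_)
open import Relation.Binary.PropositionalEquality using (_≡_; refl)

private
  variable
    S : Set

∉ˢ⇒∈ˢ∁ : (X : Subset S) {A : S} → X A ≡ false → A ∈ˢ ∁ X
∉ˢ⇒∈ˢ∁ X {A} X∌A with X A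
∉ˢ⇒∈ˢ∁ X refl | false = refl

∈ˢ⇒∉ˢ∁ : (X : Subset S) {A : S} → A ∈ˢ X → ¬ A ∈ˢ ∁ X
∈ˢ⇒∉ˢ∁ X {A} X∋A ∁X∋A with X A
∈ˢ⇒∉ˢ∁ X refl () | true

All∁⊎Any : (X : Subset S) (σ : List S) → All (_∈ˢ ∁ X) σ ⊎ Any (_∈ˢ X) σ
All∁⊎Any X [] = inj₁ []
All∁⊎Any X (A ∷ σ) with X A in XA
... | true = inj₂ (here XA)
... | false with All∁⊎Any X σ
...   | inj₁ σ⊆∁X = inj₁ (∉ˢ⇒∈ˢ∁ X XA ∷ σ⊆∁X)
...   | inj₂ σ∩X  = inj₂ (there σ∩X)

module _ {A : Set} where

  choice-meets : {w : List A} {L : List (List A)} {σ : List A} →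
    Pointwise _∈_ w L → σ ∈ L → ∃ λ x → x ∈ w × x ∈ σ
  choice-meets (x∈σ ∷ _) (here refl) = _ , here refl , x∈σ
  choice-meets (_ ∷ w∈L) (there σ∈L) with choice-meets w∈L σ∈L
  ... | x , x∈w , x∈σ = x , there x∈w , x∈σ

  choice-All : {P : A → Set} {L : List (List A)} →
    All (Any P) L → ∃ λ w → Pointwise _∈_ w L × All P w
  choice-All [] = [] , [] , []
  choice-All (Pσ ∷ PL) with find Pσ | choice-All PL
  ... | x , x∈σ , Px | w , w∈L , Pw = x ∷ w , x∈σ ∷ w∈L , Px ∷ Pw

lemma2 : {S : Set} (I J : InfSys S) →
    FiniteInConclusions I → IsComplement I J →
    (X : Subset S) (B : S) → F J X B ⇔ (¬ F I (∁ X) B)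
lemma2 I J _ (_ , complement) X B with complement B
... | L , _ , premises , choices = mk⇔ to from
  where
  to : F J X B → ¬ F I (∁ X) B
  to (w , w⊆X , J⊢B) (σ , σ⊆∁X , I⊢B)
    with choice-meets (Equivalence.to (choices w) J⊢B) (Equivalence.from (premises σ) I⊢B)
  ... | A , A∈w , A∈σ = ∈ˢ⇒∉ˢ∁ X (All.lookup w⊆X A∈w) (All.lookup σ⊆∁X A∈σ)

  from : ¬ F I (∁ X) B → F J X B
  from B∉FI∁X with choice-All (All.tabulate meetsX)
    where
    meetsX : ∀ {σ} → σ ∈ L → Any (_∈ˢ X) σ
    meetsX {σ} σ∈L with All∁⊎Any X σ
    ... | inj₁ σ⊆∁X = ⊥-elim (B∉FI∁X (σ , σ⊆∁X , Equivalence.to (premises σ) σ∈L))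
    ... | inj₂ σ∩X  = σ∩X
  ... | w , w∈L , w⊆X = w , w⊆X , Equivalence.from (choices w) w∈L
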